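{- Let $D$ be a finite simple digraph of order $n\geq 3$ with $\Delta^+(D)\geq 1$ and $\gamma_I(D)=n$. Then $r_I(D)=1$.
   Context: A finite simple digraph has no loops and no multiple arcs (oppositely oriented arcs allowed); $\Delta^+(D)$ is its maximum out-degree. An Italian dominating function (IDF) on $D$ is a function $f:V(D)\to\{0,1,2\}$ such that every vertex $v$ with $f(v)=0$ has at least two in-neighbors $w$ with $f(w)=1$ or at least one in-neighbor $w$ with $f(w)=2$; its weight is $\sum_u f(u)$ and $\gamma_I(D)$ is the minimum weight of an IDF. For a set $R$ of arcs not in $A(D)$ (between distinct vertices), $D+R$ is $D$ with these arcs added; $R$ is an Italian reinforcement set if $\gamma_I(D+R)<\gamma_I(D)$. The Italian reinforcement number $r_I(D)$ is the minimum size of such a set, defined to be $0$ if $\gamma_I(D)\leq 2$. -}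

module Defs where

open import Data.Nat using (ℕ; zero; suc; _+_; _≤_; _<_; _⊔_; _≡ᵇ_)
open import Data.Fin using (Fin)
import Data.Fin as F
open import Data.Bool using (Bool; true; false; _∧_; _∨_; if_then_else_)
open import Data.Product using (Σ; _×_; _,_)
open import Data.Sum using (_⊎_)
open import Relation.Binary.PropositionalEquality using (_≡_; _≢_)

-- Multiple arcs cannot occur; oppositely oriented arcs are allowed.
record Digraph (n : ℕ) : Set where
  field
    adj   : Fin n → Fin n → Bool
    loopless : ∀ v → adj v v ≡ false
open Digraph public

count : ∀ {n} → (Fin n → Bool) → ℕ
count {zero}  p = 0
count {suc n} p = (if p F.zero then 1 else 0) + count (λ i → p (F.suc i))

sumFin : ∀ {n} → (Fin n → ℕ) → ℕ
sumFin {zero}  f = 0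
sumFin {suc n} f = f F.zero + sumFin (λ i → f (F.suc i))

maxFin : ∀ {n} → (Fin n → ℕ) → ℕ
maxFin {zero}  f = 0
maxFin {suc n} f = f F.zero ⊔ maxFin (λ i → f (F.suc i))

outDeg : ∀ {n} → Digraph n → Fin n → ℕ
outDeg D v = count (λ w → adj D v w)

maxOutDeg : ∀ {n} → Digraph n → ℕ
maxOutDeg D = maxFin (outDeg D)

IsIDF : ∀ {n} → Digraph n → (Fin n → ℕ) → Set
IsIDF {n} D f =
  (∀ v → f v ≤ 2) ×
  (∀ v → f v ≡ 0 →
     (2 ≤ count (λ w → adj D w v ∧ (f w ≡ᵇ 1)))
     ⊎ Σ (Fin n) (λ w → (adj D w v ≡ true) × (f w ≡ 2)))

weight : ∀ {n} → (Fin n → ℕ) → ℕ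
weight f = sumFin f

IsItalianDomNumber : ∀ {n} → Digraph n → ℕ → Set
IsItalianDomNumber D k =
  Σ _ (λ f → IsIDF D f × weight f ≡ k) ×
  (∀ f → IsIDF D f → k ≤ weight f)

IsNewArcSet : ∀ {n} → Digraph n → (Fin n → Fin n → Bool) → Set
IsNewArcSet D R = ∀ u v → R u v ≡ true → (u ≢ v) × (adj D u v ≡ false)

arcCount : ∀ {n} → (Fin n → Fin n → Bool) → ℕ
arcCount R = sumFin (λ u → count (λ v → R u v))

addArcs : ∀ {n} (D : Digraph n) (R : Fin n → Fin n → Bool) →
          IsNewArcSet D R → Digraph n
addArcs D R ok = record
  { adj = λ u v → adj D u v ∨ R u v
  ; loopless = λ v → lem v
  }
  where
  open import Relation.Binary.PropositionalEquality using (refl)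
  open import Data.Empty using (⊥-elim)
  open import Data.Product using (proj₁)
  lem : ∀ v → (adj D v v ∨ R v v) ≡ false
  lem v with adj D v v | loopless D v | R v v in eq
  ... | false | _ | false = refl
  ... | false | _ | true  = ⊥-elim (proj₁ (ok v v eq) refl)

IsItalianReinforcementSet : ∀ {n} (D : Digraph n) (R : Fin n → Fin n → Bool) →
                            IsNewArcSet D R → Set
IsItalianReinforcementSet D R ok =
  Σ ℕ λ g → Σ ℕ λ h →
    IsItalianDomNumber (addArcs D R ok) g × IsItalianDomNumber D h × g < h

IsItalianReinforcementNumber : ∀ {n} → Digraph n → ℕ → Set
IsItalianReinforcementNumber D k =
  (Σ ℕ λ g → IsItalianDomNumber D g × g ≤ 2 × k ≡ 0)
  ⊎ (Σ ℕ λ g → IsItalianDomNumber D g × 2 < g ×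
      (Σ _ (λ R → Σ (IsNewArcSet D R) λ ok →
          IsItalianReinforcementSet D R ok × arcCount R ≡ k)) ×
      (∀ R (ok : IsNewArcSet D R) → IsItalianReinforcementSet D R ok →
          k ≤ arcCount R))

-- Δ⁺(D) ≥ 1 gives an arc u → w, and n ≥ 3 a third vertex x. Labelling u with 2,
-- w and x with 0 and everything else with 1 has weight n − 1, and it is an IDF
-- as soon as u → x is an arc too. Since γ_I(D) = n, the arc u → x is missing,
-- and adding it drops γ_I to n − 1: raising an IDF of D + {ux} to 1 at x yields
-- an IDF of D, so no IDF of D + {ux} weighs less than n − 1. No empty set of
-- arcs can reinforce, since adding nothing keeps every IDF an IDF.
module Submission where

open import Defs
open import Data.Nat using (ℕ; zero; suc; _+_; _*_; _≤_; _<_; _⊔_; _≡ᵇ_; z≤n; s≤s; s≤s⁻¹)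
open import Data.Nat.Properties
  using (≤-refl; ≤-trans; +-mono-≤; +-comm; +-cancelʳ-≤; <⇒≱; m+n≡0⇒m≡0; m+n≡0⇒n≡0; *-zeroʳ; *-identityʳ;
         ≡ᵇ⇒≡; ⊔-lub; m≥n⇒m⊔n≡m; m⊔n≤m+n; +-commutativeSemigroup; module ≤-Reasoning)
open import Algebra.Properties.CommutativeSemigroup +-commutativeSemigroup using (interchange)
open import Data.Fin using (Fin; _≟_)
import Data.Fin as F
open import Data.Bool using (Bool; true; false; T; _∧_; _∨_; if_then_else_)
open import Data.Bool.Properties using (¬-not; ∨-identityʳ; ∨-zeroʳ)
open import Data.Product using (Σ; ∃; ∃₂; _×_; _,_; proj₁; proj₂)
open import Data.Sum using (_⊎_; inj₁; inj₂)
open import Data.Empty using (⊥-elim)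
open import Function using (id; _∘_)
open import Relation.Nullary using (does; yes; no)
open import Relation.Nullary.Decidable using (dec-true)
open import Relation.Binary.PropositionalEquality

private
  variable
    n : ℕ

∧-mono : ∀ {a b c d} → (a ≡ true → c ≡ true) → (b ≡ true → d ≡ true) →
         a ∧ b ≡ true → c ∧ d ≡ true
∧-mono {true} {true} a⇒c b⇒d _ rewrite a⇒c refl | b⇒d refl = refl

m⊔n≡0⇒m≡0×n≡0 : ∀ m n → m ⊔ n ≡ 0 → m ≡ 0 × n ≡ 0
m⊔n≡0⇒m≡0×n≡0 zero    zero    _ = refl , refl
m⊔n≡0⇒m≡0×n≡0 zero    (suc n) ()
m⊔n≡0⇒m≡0×n≡0 (suc m) zero    ()
m⊔n≡0⇒m≡0×n≡0 (suc m) (suc n) ()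

sumFin-cong : {f g : Fin n → ℕ} → (∀ i → f i ≡ g i) → sumFin f ≡ sumFin g
sumFin-cong {zero}  f≗g = refl
sumFin-cong {suc n} f≗g = cong₂ _+_ (f≗g F.zero) (sumFin-cong (f≗g ∘ F.suc))

sumFin-mono : {f g : Fin n → ℕ} → (∀ i → f i ≤ g i) → sumFin f ≤ sumFin g
sumFin-mono {zero}  f≤g = z≤n
sumFin-mono {suc n} f≤g = +-mono-≤ (f≤g F.zero) (sumFin-mono (f≤g ∘ F.suc))

sumFin-+ : (f g : Fin n → ℕ) → sumFin (λ i → f i + g i) ≡ sumFin f + sumFin g
sumFin-+ {zero}  f g = refl
sumFin-+ {suc n} f g = trans (cong (f F.zero + g F.zero +_) (sumFin-+ (f ∘ F.suc) (g ∘ F.suc)))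
                             (interchange (f F.zero) (g F.zero) _ _)

sumFin-const : ∀ n c → sumFin {n} (λ _ → c) ≡ n * c
sumFin-const zero    c = refl
sumFin-const (suc n) c = cong (c +_) (sumFin-const n c)

sumFin≡0⇒≡0 : (f : Fin n → ℕ) → sumFin f ≡ 0 → ∀ i → f i ≡ 0
sumFin≡0⇒≡0 f e F.zero    = m+n≡0⇒m≡0 (f F.zero) e
sumFin≡0⇒≡0 f e (F.suc i) = sumFin≡0⇒≡0 (f ∘ F.suc) (m+n≡0⇒n≡0 (f F.zero) e) i

δ : Fin n → Fin n → ℕ
δ x y = if does (y ≟ x) then 1 else 0

δ≤1 : (x y : Fin n) → δ x y ≤ 1
δ≤1 x y with y ≟ x
... | yes _ = ≤-refl
... | no  _ = z≤n

δ≡0⇒≢ : {x y : Fin n} → δ x y ≡ 0 → y ≢ x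
δ≡0⇒≢ {x = x} {y} e y≡x with y ≟ x
δ≡0⇒≢ () y≡x | yes _
... | no y≢x = y≢x y≡x

sumFin-δ : (x : Fin n) → sumFin (δ x) ≡ 1
sumFin-δ {suc n} F.zero    = cong suc (trans (sumFin-const n 0) (*-zeroʳ n))
sumFin-δ {suc n} (F.suc x) = sumFin-δ {n} x

count≡sumFin : (p : Fin n → Bool) → count p ≡ sumFin (λ i → if p i then 1 else 0)
count≡sumFin {zero}  p = refl
count≡sumFin {suc n} p = cong ((if p F.zero then 1 else 0) +_) (count≡sumFin (p ∘ F.suc))

count-false : ∀ n → count {n} (λ _ → false) ≡ 0
count-false n = trans (count≡sumFin {n} (λ _ → false)) (trans (sumFin-const n 0) (*-zeroʳ n))

count-≟ : (x : Fin n) → count (λ y → does (y ≟ x)) ≡ 1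
count-≟ x = trans (count≡sumFin (λ y → does (y ≟ x))) (sumFin-δ x)

count-mono : {p q : Fin n → Bool} → (∀ i → p i ≡ true → q i ≡ true) → count p ≤ count q
count-mono {zero}  p⇒q = z≤n
count-mono {suc n} p⇒q = +-mono-≤ (indicator-mono (p⇒q F.zero)) (count-mono (p⇒q ∘ F.suc))
  where
  indicator-mono : ∀ {a b} → (a ≡ true → b ≡ true) → (if a then 1 else 0) ≤ (if b then 1 else 0)
  indicator-mono {false} _   = z≤n
  indicator-mono {true}  a⇒b rewrite a⇒b refl = ≤-refl

count≡0⇒≡false : (p : Fin n → Bool) → count p ≡ 0 → ∀ i → p i ≡ false
count≡0⇒≡false {suc n} p e i with p F.zero in p₀
count≡0⇒≡false {suc n} p () i | true
count≡0⇒≡false {suc n} p e F.zero    | false = p₀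
count≡0⇒≡false {suc n} p e (F.suc i) | false = count≡0⇒≡false (p ∘ F.suc) e i

count≥1⇒∃ : (p : Fin n → Bool) → 1 ≤ count p → ∃ λ i → p i ≡ true
count≥1⇒∃ {suc n} p c with p F.zero in p₀
... | true  = F.zero , p₀
... | false with count≥1⇒∃ (p ∘ F.suc) c
...   | i , pᵢ = F.suc i , pᵢ

maxFin≥1⇒∃ : (f : Fin n → ℕ) → 1 ≤ maxFin f → ∃ λ i → 1 ≤ f i
maxFin≥1⇒∃ {suc n} f m with f F.zero in f₀
... | suc _ = F.zero , subst (1 ≤_) (sym f₀) (s≤s z≤n)
... | zero with maxFin≥1⇒∃ (f ∘ F.suc) m
...   | i , fᵢ = F.suc i , fᵢ

third-vertex : 3 ≤ n → (u w : Fin n) → ∃ λ x → x ≢ u × x ≢ w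
third-vertex (s≤s (s≤s (s≤s _))) F.zero F.zero = F.suc F.zero , (λ ()) , (λ ())
third-vertex (s≤s (s≤s (s≤s _))) F.zero (F.suc F.zero) = F.suc (F.suc F.zero) , (λ ()) , (λ ())
third-vertex (s≤s (s≤s (s≤s _))) F.zero (F.suc (F.suc _)) = F.suc F.zero , (λ ()) , (λ ())
third-vertex (s≤s (s≤s (s≤s _))) (F.suc F.zero) F.zero = F.suc (F.suc F.zero) , (λ ()) , (λ ())
third-vertex (s≤s (s≤s (s≤s _))) (F.suc F.zero) (F.suc F.zero) = F.zero , (λ ()) , (λ ())
third-vertex (s≤s (s≤s (s≤s _))) (F.suc F.zero) (F.suc (F.suc _)) = F.zero , (λ ()) , (λ ())
third-vertex (s≤s (s≤s (s≤s _))) (F.suc (F.suc _)) F.zero = F.suc F.zero , (λ ()) , (λ ())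
third-vertex (s≤s (s≤s (s≤s _))) (F.suc (F.suc _)) (F.suc _) = F.zero , (λ ()) , (λ ())

maxOutDeg≥1⇒∃-arc : (D : Digraph n) → 1 ≤ maxOutDeg D → ∃₂ λ u w → adj D u w ≡ true
maxOutDeg≥1⇒∃-arc D Δ⁺≥1 with maxFin≥1⇒∃ (outDeg D) Δ⁺≥1
... | u , d⁺u≥1 with count≥1⇒∃ (adj D u) d⁺u≥1
...   | w , u→w = u , w , u→w

arc⇒≢ : (D : Digraph n) {u w : Fin n} → adj D u w ≡ true → u ≢ w
arc⇒≢ D {u} u→w refl with trans (sym (loopless D u)) u→w
... | ()

addArcs-⊇ : (D : Digraph n) {R : Fin n → Fin n → Bool} (ok : IsNewArcSet D R) {a b : Fin n} →
            adj D a b ≡ true → adj (addArcs D R ok) a b ≡ true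
addArcs-⊇ D {R} ok {a} {b} a→b rewrite a→b = refl

addArcs-⊇R : (D : Digraph n) {R : Fin n → Fin n → Bool} (ok : IsNewArcSet D R) {a b : Fin n} →
             R a b ≡ true → adj (addArcs D R ok) a b ≡ true
addArcs-⊇R D {R} ok {a} {b} r rewrite r = ∨-zeroʳ (adj D a b)

addArcs-arc⇒arc : (D : Digraph n) {R : Fin n → Fin n → Bool} (ok : IsNewArcSet D R) {a b : Fin n} →
                  R a b ≡ false → adj (addArcs D R ok) a b ≡ true → adj D a b ≡ true
addArcs-arc⇒arc D ok {a} {b} notNew a→b =
  trans (sym (∨-identityʳ (adj D a b))) (trans (cong (adj D a b ∨_) (sym notNew)) a→b)

ItalianDominated : Digraph n → (Fin n → ℕ) → Fin n → Set
ItalianDominated {n} D f v =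
  (2 ≤ count (λ w → adj D w v ∧ (f w ≡ᵇ 1))) ⊎ Σ (Fin n) (λ w → (adj D w v ≡ true) × (f w ≡ 2))

IsIDF-arcs : (D D' : Digraph n) {g : Fin n → ℕ} →
             (∀ v → g v ≡ 0 → ∀ w → adj D w v ≡ true → adj D' w v ≡ true) →
             IsIDF D g → IsIDF D' g
IsIDF-arcs D D' {g} keep (bounded , dominated) = bounded , dominated'
  where
  dominated' : ∀ v → g v ≡ 0 → ItalianDominated D' g v
  dominated' v gv≡0 with dominated v gv≡0
  ... | inj₁ two = inj₁ (≤-trans two (count-mono (λ w → ∧-mono (keep v gv≡0 w) id)))
  ... | inj₂ (w , w→v , gw≡2) = inj₂ (w , keep v gv≡0 w w→v , gw≡2)

IsIDF-relabel : (D : Digraph n) {g g' : Fin n → ℕ} →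
                (∀ v → g' v ≤ 2) → (∀ v → g' v ≡ 0 → g v ≡ 0) →
                (∀ w k → g w ≡ suc k → g' w ≡ g w) →
                IsIDF D g → IsIDF D g'
IsIDF-relabel D {g} {g'} bounded' zeros positives (_ , dominated) = bounded' , dominated'
  where
  keeps-1 : ∀ w → (g w ≡ᵇ 1) ≡ true → (g' w ≡ᵇ 1) ≡ true
  keeps-1 w e = cong (_≡ᵇ 1) (trans (positives w 0 gw≡1) gw≡1)
    where
    gw≡1 : g w ≡ 1
    gw≡1 = ≡ᵇ⇒≡ (g w) 1 (subst T (sym e) _)
  dominated' : ∀ v → g' v ≡ 0 → ItalianDominated D g' v
  dominated' v g'v≡0 with dominated v (zeros v g'v≡0)
  ... | inj₁ two = inj₁ (≤-trans two (count-mono (λ w → ∧-mono id (keeps-1 w))))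
  ... | inj₂ (w , w→v , gw≡2) = inj₂ (w , w→v , trans (positives w 1 gw≡2) gw≡2)

reinforcementSet-nonempty : (D : Digraph n) (R : Fin n → Fin n → Bool) (ok : IsNewArcSet D R) →
                            IsItalianReinforcementSet D R ok → 1 ≤ arcCount R
reinforcementSet-nonempty D R ok (g , h , ((f , f-IDF , f-weight) , _) , (_ , h-min) , g<h)
  with arcCount R in noArcs
... | suc _ = s≤s z≤n
... | zero  = ⊥-elim (<⇒≱ g<h (subst (h ≤_) f-weight (h-min f f-IDF-of-D)))
  where
  onlyOld : ∀ v → f v ≡ 0 → ∀ w → adj D w v ∨ R w v ≡ true → adj D w v ≡ true
  onlyOld v _ w = addArcs-arc⇒arc D ok (count≡0⇒≡false (R w) (sumFin≡0⇒≡0 _ noArcs w) v)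
  f-IDF-of-D : IsIDF D f
  f-IDF-of-D = IsIDF-arcs (addArcs D R ok) D onlyOld f-IDF

addArcsInto-weight : (D : Digraph n) (R : Fin n → Fin n → Bool) (ok : IsNewArcSet D R) (x : Fin n) →
                     (∀ a b → R a b ≡ true → b ≡ x) →
                     ∀ {k} → IsItalianDomNumber D k →
                     ∀ g → IsIDF (addArcs D R ok) g → k ≤ weight g + 1
addArcsInto-weight {n} D R ok x into-x (_ , k-min) g g-IDF = ≤-trans (k-min raised raised-IDF) raised-weight
  where
  raised : Fin n → ℕ
  raised y = g y ⊔ δ x y
  raised-IDF : IsIDF D raised
  raised-IDF = IsIDF-arcs (addArcs D R ok) D awayFromX
                 (IsIDF-relabel (addArcs D R ok) bounded zeros positives g-IDF)
    where
    bounded : ∀ y → raised y ≤ 2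
    bounded y = ⊔-lub (proj₁ g-IDF y) (≤-trans (δ≤1 x y) (s≤s z≤n))
    zeros : ∀ y → raised y ≡ 0 → g y ≡ 0
    zeros y = proj₁ ∘ m⊔n≡0⇒m≡0×n≡0 (g y) (δ x y)
    positives : ∀ y k → g y ≡ suc k → raised y ≡ g y
    positives y k gy≡1+k rewrite gy≡1+k = m≥n⇒m⊔n≡m (≤-trans (δ≤1 x y) (s≤s z≤n))
    awayFromX : ∀ v → raised v ≡ 0 → ∀ w → adj D w v ∨ R w v ≡ true → adj D w v ≡ true
    awayFromX v raised≡0 w = addArcs-arc⇒arc D ok (¬-not (v≢x ∘ into-x w v))
      where
      v≢x : v ≢ x
      v≢x = δ≡0⇒≢ (proj₂ (m⊔n≡0⇒m≡0×n≡0 (g v) (δ x v) raised≡0))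
  raised-weight : weight raised ≤ weight g + 1
  raised-weight = begin
    sumFin raised                      ≤⟨ sumFin-mono (λ y → m⊔n≤m+n (g y) (δ x y)) ⟩
    sumFin (λ y → g y + δ x y)         ≡⟨ sumFin-+ g (δ x) ⟩
    weight g + sumFin (δ x)            ≡⟨ cong (weight g +_) (sumFin-δ x) ⟩
    weight g + 1                       ∎
    where open ≤-Reasoning

star : (u w x : Fin n) → Fin n → ℕ
star u w x y = if does (y ≟ u) then 2 else if does (y ≟ w) ∨ does (y ≟ x) then 0 else 1

star-IDF : (G : Digraph n) {u w x : Fin n} → adj G u w ≡ true → adj G u x ≡ true →
           IsIDF G (star u w x)
star-IDF G {u} {w} {x} u→w u→x = bounded , dominated
  where
  bounded : ∀ y → star u w x y ≤ 2
  bounded y with does (y ≟ u) | does (y ≟ w) ∨ does (y ≟ x)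
  ... | true  | _     = ≤-refl
  ... | false | true  = z≤n
  ... | false | false = s≤s z≤n
  centre : star u w x u ≡ 2
  centre rewrite dec-true (u ≟ u) refl = refl
  dominated : ∀ v → star u w x v ≡ 0 → ItalianDominated G (star u w x) v
  dominated v sv≡0 with v ≟ u | v ≟ w | v ≟ x
  dominated v () | yes _ | _ | _
  ... | no _ | yes refl | _        = inj₂ (u , u→w , centre)
  ... | no _ | no _     | yes refl = inj₂ (u , u→x , centre)
  dominated v () | no _ | no _ | no _

star-weight : {u w x : Fin n} → u ≢ w → x ≢ u → x ≢ w → weight (star u w x) < n
star-weight {n} {u} {w} {x} u≢w x≢u x≢w = s≤s⁻¹ (begin
    2 + weight s                                 ≡⟨ cong (_+ weight s) (cong₂ _+_ (sumFin-δ w) (sumFin-δ x)) ⟨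
    (sumFin (δ w) + sumFin (δ x)) + weight s     ≡⟨ cong (_+ weight s) (sumFin-+ (δ w) (δ x)) ⟨
    sumFin (λ y → δ w y + δ x y) + weight s      ≡⟨ sumFin-+ (λ y → δ w y + δ x y) s ⟨
    sumFin (λ y → δ w y + δ x y + s y)           ≤⟨ sumFin-mono pointwise ⟩
    sumFin (λ y → δ u y + 1)                     ≡⟨ sumFin-+ (δ u) (λ _ → 1) ⟩
    sumFin (δ u) + sumFin {n} (λ _ → 1)          ≡⟨ cong₂ _+_ (sumFin-δ u) (sumFin-const n 1) ⟩
    1 + n * 1                                    ≡⟨ cong suc (*-identityʳ n) ⟩
    1 + n                                        ∎)
  where
  open ≤-Reasoning
  s : Fin n → ℕ
  s = star u w x
  pointwise : ∀ y → δ w y + δ x y + s y ≤ δ u y + 1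
  pointwise y with y ≟ u | y ≟ w | y ≟ x
  ... | yes y≡u | yes y≡w | _       = ⊥-elim (u≢w (trans (sym y≡u) y≡w))
  ... | yes y≡u | no _    | yes y≡x = ⊥-elim (x≢u (trans (sym y≡x) y≡u))
  ... | no _    | yes y≡w | yes y≡x = ⊥-elim (x≢w (trans (sym y≡x) y≡w))
  ... | yes _   | no _    | no _    = ≤-refl
  ... | no _    | yes _   | no _    = ≤-refl
  ... | no _    | no _    | yes _   = ≤-refl
  ... | no _    | no _    | no _    = ≤-refl

singleArc : Fin n → Fin n → Fin n → Fin n → Bool
singleArc u x a b = does (a ≟ u) ∧ does (b ≟ x)

singleArc-into : (u x : Fin n) → ∀ a b → singleArc u x a b ≡ true → b ≡ x
singleArc-into u x a b e with a ≟ u | b ≟ x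
... | yes _ | yes b≡x = b≡x

singleArc-new : (D : Digraph n) {u x : Fin n} → u ≢ x → adj D u x ≡ false →
                IsNewArcSet D (singleArc u x)
singleArc-new D {u} {x} u≢x u↛x a b e with a ≟ u | b ≟ x
... | yes refl | yes refl = u≢x , u↛x

arcCount-singleArc : (u x : Fin n) → arcCount (singleArc u x) ≡ 1
arcCount-singleArc {n} u x = trans (sumFin-cong row) (sumFin-δ u)
  where
  row : ∀ a → count (singleArc u x a) ≡ δ u a
  row a with a ≟ u
  ... | yes _ = count-≟ x
  ... | no  _ = count-false n

γ≡n⇒no-second-out-neighbour : (D : Digraph n) {u w x : Fin n} → IsItalianDomNumber D n →
                              adj D u w ≡ true → x ≢ u → x ≢ w → adj D u x ≡ false
γ≡n⇒no-second-out-neighbour D (_ , n-min) u→w x≢u x≢w = ¬-not λ u→x →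
  <⇒≱ (star-weight (arc⇒≢ D u→w) x≢u x≢w) (n-min _ (star-IDF D u→w u→x))

singleArc-reinforces : (D : Digraph n) {u w x : Fin n} → IsItalianDomNumber D n →
                       adj D u w ≡ true → x ≢ u → x ≢ w →
                       Σ (Fin n → Fin n → Bool) λ R → Σ (IsNewArcSet D R) λ ok →
                         IsItalianReinforcementSet D R ok × arcCount R ≡ 1
singleArc-reinforces {n} D {u} {w} {x} γD u→w x≢u x≢w =
  singleArc u x , ok , (weight s , n , ((s , s-IDF , refl) , s-min) , γD , s<n) , arcCount-singleArc u x
  where
  ok : IsNewArcSet D (singleArc u x)
  ok = singleArc-new D (x≢u ∘ sym) (γ≡n⇒no-second-out-neighbour D γD u→w x≢u x≢w)
  D' : Digraph n
  D' = addArcs D (singleArc u x) ok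
  s : Fin n → ℕ
  s = star u w x
  s<n : weight s < n
  s<n = star-weight (arc⇒≢ D u→w) x≢u x≢w
  s-IDF : IsIDF D' s
  s-IDF = star-IDF D' (addArcs-⊇ D ok u→w)
                      (addArcs-⊇R D ok (cong₂ _∧_ (dec-true (u ≟ u) refl) (dec-true (x ≟ x) refl)))
  s-min : ∀ g → IsIDF D' g → weight s ≤ weight g
  s-min g g-IDF = +-cancelʳ-≤ 1 _ _ (≤-trans (subst (_≤ n) (+-comm 1 _) s<n)
                    (addArcsInto-weight D _ ok x (singleArc-into u x) γD g g-IDF))

lemma4p2 : (n : ℕ) (D : Digraph n) → 3 ≤ n → 1 ≤ maxOutDeg D →
    IsItalianDomNumber D n → IsItalianReinforcementNumber D 1
lemma4p2 n D 3≤n Δ⁺≥1 γD with maxOutDeg≥1⇒∃-arc D Δ⁺≥1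
... | u , w , u→w with third-vertex 3≤n u w
...   | x , x≢u , x≢w =
  inj₂ (n , γD , 3≤n , singleArc-reinforces D γD u→w x≢u x≢w , reinforcementSet-nonempty D)
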